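{- Let $k$ be a positive integer. (1) If $H$ is a $(2k+1,k+1)$-bigraph, then for every edge $e\in E(H)$ there exists a 1-factor of $H$ containing $e$. (2) If $H$ is a $(2k+1,k)$-bigraph with parts $A,B$ that has no 1-factor, then there exist $X\subseteq A$ and $Y\subseteq B$ with $|X|=|Y|=k+1$ and no edges between $X$ and $Y$; furthermore, such $X$ and $Y$ are unique, $X$ is complete to $B\setminus Y$, and $Y$ is complete to $A\setminus X$.
   Context: A bigraph is a bipartite graph with parts $A$ and $B$ such that $|A|=|B|$. An $(s,t)$-bigraph is a bigraph with $|A|=|B|=s$ and minimum degree at least $t$. -}

module Defs where

open import Data.Nat using (ℕ; _≤_)
open import Data.Bool using (Bool; true; false)
open import Data.Fin using (Fin)
open import Data.Fin.Subset using (Subset; _∈_; _∉_; ∣_∣)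
open import Data.Vec using (tabulate)
open import Data.Product using (Σ; _×_; _,_)
open import Data.Fin.Permutation using (Permutation′; _⟨$⟩ʳ_)
open import Relation.Binary.PropositionalEquality using (_≡_)

-- A bigraph with parts A = Fin s and B = Fin s: an adjacency relation
-- given as a Boolean matrix  adj a b  (true iff a ∈ A is adjacent to b ∈ B).
record Bigraph (s : ℕ) : Set where
  field
    adj : Fin s → Fin s → Bool
open Bigraph public

Edge : ∀ {s} → Bigraph s → Fin s → Fin s → Set
Edge H a b = adj H a b ≡ true

NA : ∀ {s} → Bigraph s → Fin s → Subset s
NA H a = tabulate (λ b → adj H a b)

NB : ∀ {s} → Bigraph s → Fin s → Subset s
NB H b = tabulate (λ a → adj H a b)

degA : ∀ {s} → Bigraph s → Fin s → ℕ
degA H a = ∣ NA H a ∣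

degB : ∀ {s} → Bigraph s → Fin s → ℕ
degB H b = ∣ NB H b ∣

MinDeg≥ : ∀ {s} → Bigraph s → ℕ → Set
MinDeg≥ {s} H t = ((a : Fin s) → t ≤ degA H a) × ((b : Fin s) → t ≤ degB H b)

STBigraph : ℕ → ℕ → Set
STBigraph s t = Σ (Bigraph s) (λ H → MinDeg≥ H t)

OneFactor : ∀ {s} → Bigraph s → Set
OneFactor {s} H = Σ (Permutation′ s) (λ σ → (a : Fin s) → Edge H a (σ ⟨$⟩ʳ a))

Contains : ∀ {s} {H : Bigraph s} → OneFactor H → Fin s → Fin s → Set
Contains (σ , _) a b = σ ⟨$⟩ʳ a ≡ b

NoEdges : ∀ {s} → Bigraph s → Subset s → Subset s → Set
NoEdges {s} H X Y = (a b : Fin s) → a ∈ X → b ∈ Y → adj H a b ≡ false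

CompleteTo : ∀ {s} → Bigraph s → Subset s → Subset s → Set
CompleteTo {s} H X Z = (a b : Fin s) → a ∈ X → b ∈ Z → Edge H a b

{-# OPTIONS --safe #-}
-- Repair a bijection σ : A → B by local moves, each strictly enlarging the set of vertices a with
-- a σ(a) ∈ E.  If a σ(a) ∉ E, put P = σ⁻¹ N(a) and Q = N(σ a); both avoid a, and exchanging the
-- partners of a and of any x ∈ P ∩ Q repairs a without breaking anything.
-- (1) With degrees ≥ k + 1 we get ∣P ∩ Q∣ ≥ 2, so x can avoid the endpoint a₀ of the prescribed
-- edge a₀ b₀, and a₀ keeps its partner b₀ throughout.
-- (2) With degrees ≥ k also use the rotation a ↦ σ x, x ↦ σ z, z ↦ σ a.  When neither move is
-- available, P and Q are disjoint k-sets partitioning A ∖ {a}, and X = A ∖ Q, Y = B ∖ N(a) span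
-- no edge.  For any edgeless pair of (k + 1)-sets, every y ∈ Y has its ≥ k neighbours inside the
-- k-set A ∖ X, so N(y) = A ∖ X: this is the completeness, and uniqueness follows as two such Y meet.
module Submission where

open import Defs
import Algebra.Properties.CommutativeMonoid.Sum as CommutativeMonoidSum
open import Data.Bool using (Bool; true; false; if_then_else_)
open import Data.Bool.Properties using (¬-not; not-¬) renaming (_≟_ to _≟ᵇ_)
open import Data.Empty using (⊥)
open import Data.Fin using (Fin; zero; suc; _≟_)
open import Data.Fin.Permutation using (Permutation′; id; _⟨$⟩ʳ_; _⟨$⟩ˡ_; _∘ₚ_; transpose; inverseʳ)
import Data.Fin.Permutation.Components as PC
open import Data.Fin.Properties using (any?)
open import Data.Fin.Subset
  using (Subset; _∈_; _∉_; _⊆_; _⊂_; _⊃_; _∪_; _∩_; ∁; ⁅_⁆; ⊤; _-_; ∣_∣; Nonempty; Empty)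
  renaming (⊥ to ∅)
open import Data.Fin.Subset.Induction using (⊃-wellFounded)
open import Data.Fin.Subset.Properties
  using ( _∈?_; ∈⊤; ⊆⊤; ∣⊤∣≡n; ∣⊥∣≡0; ∣⁅x⁆∣≡1; ∣p∣≤n; ∣∁p∣≡n∸∣p∣; p⊆q⇒∣p∣≤∣q∣; p⊂q⇒∣p∣<∣q∣
        ; ⊆-antisym; ⊆-reflexive; ∁p⊆∁q⇒p⊇q; x∈p⇒∣p-x∣<∣p∣; x∈p∧x≢y⇒x∈p-y
        ; x∉⁅y⁆⇒x≢y; x∉p⇒x∈∁p; x∈∁p⇒x∉p; x∈p∩q⁺; x∈p∩q⁻; x∈p∪q⁻; nonempty?; Empty-unique )
open import Data.Nat using (ℕ; zero; suc; _+_; _*_; _∸_; _≤_; _<_; s≤s)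
open import Data.Nat.Properties
  using ( +-0-commutativeMonoid; +-suc; +-comm; +-identityʳ; +-mono-≤; +-monoˡ-≤; +-monoʳ-≤
        ; +-cancelˡ-≤; +-cancelʳ-≤; ≤-trans; ≤-reflexive; ≤-antisym; ≤-pred; <⇒≱; 1+n≰n
        ; m+n∸m≡n; module ≤-Reasoning )
open import Data.Nat.Tactic.RingSolver using (solve-∀)
open import Data.Product using (∃; ∃₂; Σ; _×_; _,_; proj₁; proj₂)
open import Data.Sum using (inj₁; inj₂; _⊎_; [_,_]′)
open import Data.Unit using (tt) renaming (⊤ to Unit)
open import Data.Vec using ([]; _∷_; tabulate)
open import Data.Vec.Properties using (lookup∘tabulate; []=⇒lookup; lookup⇒[]=)
open import Function using (_∘_; _on_; flip)
open import Induction.WellFounded using (Acc; acc)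
import Relation.Binary.Construct.On as On
open import Relation.Binary.PropositionalEquality
open import Relation.Nullary using (¬_; yes; no; ¬?; contradiction)
open import Relation.Nullary.Decidable using (_×-dec_; decidable-stable; toSum)

private
  variable
    n : ℕ
    p q : Subset n

∈-tabulate⁺ : (f : Fin n → Bool) {x : Fin n} → f x ≡ true → x ∈ tabulate f
∈-tabulate⁺ f {x} fx = lookup⇒[]= x (tabulate f) (trans (lookup∘tabulate f x) fx)

∈-tabulate⁻ : (f : Fin n → Bool) {x : Fin n} → x ∈ tabulate f → f x ≡ true
∈-tabulate⁻ f {x} x∈ = trans (sym (lookup∘tabulate f x)) ([]=⇒lookup x∈)

module ℕ-Sum = CommutativeMonoidSum +-0-commutativeMonoid

∣tabulate∣≡sum : (f : Fin n → Bool) → ∣ tabulate f ∣ ≡ ℕ-Sum.sum (λ i → if f i then 1 else 0)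
∣tabulate∣≡sum {zero}  f = refl
∣tabulate∣≡sum {suc n} f with f zero
... | true  = cong suc (∣tabulate∣≡sum (f ∘ suc))
... | false = ∣tabulate∣≡sum (f ∘ suc)

∣tabulate∘permute∣ : (f : Fin n → Bool) (π : Permutation′ n) →
                     ∣ tabulate (f ∘ (π ⟨$⟩ʳ_)) ∣ ≡ ∣ tabulate f ∣
∣tabulate∘permute∣ f π = begin
  ∣ tabulate (f ∘ (π ⟨$⟩ʳ_)) ∣          ≡⟨ ∣tabulate∣≡sum (f ∘ (π ⟨$⟩ʳ_)) ⟩
  ℕ-Sum.sum (indicator ∘ (π ⟨$⟩ʳ_))   ≡⟨ ℕ-Sum.sum-permute indicator π ⟨
  ℕ-Sum.sum indicator                  ≡⟨ ∣tabulate∣≡sum f ⟨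
  ∣ tabulate f ∣                        ∎
  where
  open ≡-Reasoning
  indicator : Fin _ → ℕ
  indicator i = if f i then 1 else 0

∣p∪q∣+∣p∩q∣≡∣p∣+∣q∣ : (p q : Subset n) → ∣ p ∪ q ∣ + ∣ p ∩ q ∣ ≡ ∣ p ∣ + ∣ q ∣
∣p∪q∣+∣p∩q∣≡∣p∣+∣q∣ []          []          = refl
∣p∪q∣+∣p∩q∣≡∣p∣+∣q∣ (true  ∷ p) (true  ∷ q) =
  cong suc (trans (+-suc _ _) (trans (cong suc (∣p∪q∣+∣p∩q∣≡∣p∣+∣q∣ p q)) (sym (+-suc _ _))))
∣p∪q∣+∣p∩q∣≡∣p∣+∣q∣ (true  ∷ p) (false ∷ q) = cong suc (∣p∪q∣+∣p∩q∣≡∣p∣+∣q∣ p q)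
∣p∪q∣+∣p∩q∣≡∣p∣+∣q∣ (false ∷ p) (true  ∷ q) =
  trans (cong suc (∣p∪q∣+∣p∩q∣≡∣p∣+∣q∣ p q)) (sym (+-suc _ _))
∣p∪q∣+∣p∩q∣≡∣p∣+∣q∣ (false ∷ p) (false ∷ q) = ∣p∪q∣+∣p∩q∣≡∣p∣+∣q∣ p q

∣p∪q∣+m≤∣p∣+∣q∣⇒m≤∣p∩q∣ : ∀ (p q : Subset n) {m} → ∣ p ∪ q ∣ + m ≤ ∣ p ∣ + ∣ q ∣ → m ≤ ∣ p ∩ q ∣
∣p∪q∣+m≤∣p∣+∣q∣⇒m≤∣p∩q∣ p q le =
  +-cancelˡ-≤ ∣ p ∪ q ∣ _ _ (≤-trans le (≤-reflexive (sym (∣p∪q∣+∣p∩q∣≡∣p∣+∣q∣ p q))))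

Empty[p∩q]⇒∣p∪q∣≡∣p∣+∣q∣ : (p q : Subset n) → Empty (p ∩ q) → ∣ p ∪ q ∣ ≡ ∣ p ∣ + ∣ q ∣
Empty[p∩q]⇒∣p∪q∣≡∣p∣+∣q∣ {n} p q disjoint = begin
  ∣ p ∪ q ∣               ≡⟨ +-identityʳ _ ⟨
  ∣ p ∪ q ∣ + 0           ≡⟨ cong (∣ p ∪ q ∣ +_) (∣⊥∣≡0 n) ⟨
  ∣ p ∪ q ∣ + ∣ ∅ {n} ∣   ≡⟨ cong (λ r → ∣ p ∪ q ∣ + ∣ r ∣) (Empty-unique disjoint) ⟨
  ∣ p ∪ q ∣ + ∣ p ∩ q ∣   ≡⟨ ∣p∪q∣+∣p∩q∣≡∣p∣+∣q∣ p q ⟩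
  ∣ p ∣ + ∣ q ∣           ∎
  where open ≡-Reasoning

∣q∣<∣p∣⇒∃∈p∖q : ∣ q ∣ < ∣ p ∣ → ∃ λ x → x ∈ p × x ∉ q
∣q∣<∣p∣⇒∃∈p∖q {q = q} {p = p} ∣q∣<∣p∣ with any? (λ x → x ∈? p ×-dec ¬? (x ∈? q))
... | yes found = found
... | no  none  = contradiction (p⊆q⇒∣p∣≤∣q∣ p⊆q) (<⇒≱ ∣q∣<∣p∣)
  where
  p⊆q : p ⊆ q
  p⊆q {x} x∈p = decidable-stable (x ∈? q) (λ x∉q → none (x , x∈p , x∉q))

n<∣p∣+∣q∣⇒Nonempty[p∩q] : (p q : Subset n) → n < ∣ p ∣ + ∣ q ∣ → Nonempty (p ∩ q)
n<∣p∣+∣q∣⇒Nonempty[p∩q] {n} p q n<∣p∣+∣q∣ =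
  let (x , x∈p∩q , _) = ∣q∣<∣p∣⇒∃∈p∖q {q = ∅} (subst (_< ∣ p ∩ q ∣) (sym (∣⊥∣≡0 n)) 0<∣p∩q∣)
  in x , x∈p∩q
  where
  0<∣p∩q∣ : 1 ≤ ∣ p ∩ q ∣
  0<∣p∩q∣ = ∣p∪q∣+m≤∣p∣+∣q∣⇒m≤∣p∩q∣ p q (begin
    ∣ p ∪ q ∣ + 1   ≤⟨ +-monoˡ-≤ 1 (∣p∣≤n (p ∪ q)) ⟩
    n + 1           ≡⟨ +-comm n 1 ⟩
    suc n           ≤⟨ n<∣p∣+∣q∣ ⟩
    ∣ p ∣ + ∣ q ∣   ∎)
    where open ≤-Reasoning

p⊆q⇒∣q∣≤∣p∣⇒p≡q : p ⊆ q → ∣ q ∣ ≤ ∣ p ∣ → p ≡ q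
p⊆q⇒∣q∣≤∣p∣⇒p≡q {p = p} {q = q} p⊆q ∣q∣≤∣p∣ = ⊆-antisym p⊆q q⊆p
  where
  q⊆p : q ⊆ p
  q⊆p {x} x∈q = decidable-stable (x ∈? p) (λ x∉p → <⇒≱ (p⊂q⇒∣p∣<∣q∣ (p⊆q , x , x∈q , x∉p)) ∣q∣≤∣p∣)

∁-injective : ∁ p ≡ ∁ q → p ≡ q
∁-injective ∁p≡∁q = ⊆-antisym (∁p⊆∁q⇒p⊇q (⊆-reflexive (sym ∁p≡∁q))) (∁p⊆∁q⇒p⊇q (⊆-reflexive ∁p≡∁q))

∣p∣≡m⇒∣∁p∣≡n∸m : ∀ {p : Subset n} {m} → ∣ p ∣ ≡ m → ∣ ∁ p ∣ ≡ n ∸ m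
∣p∣≡m⇒∣∁p∣≡n∸m {p = p} refl = ∣∁p∣≡n∸∣p∣ p

x∉p⇒∣p∣<n : {x : Fin n} {p : Subset n} → x ∉ p → ∣ p ∣ < n
x∉p⇒∣p∣<n {n} {x} {p} x∉p = subst (∣ p ∣ <_) (∣⊤∣≡n n) (p⊂q⇒∣p∣<∣q∣ (⊆⊤ , x , ∈⊤ , x∉p))

x≢y∉p⇒2+∣p∣≤n : ∀ {n} {x y : Fin n} {p : Subset n} → x ≢ y → x ∉ p → y ∉ p → 2 + ∣ p ∣ ≤ n
x≢y∉p⇒2+∣p∣≤n {n} {x} {y} {p} x≢y x∉p y∉p = begin
  2 + ∣ p ∣        ≤⟨ s≤s (p⊂q⇒∣p∣<∣q∣ (p⊆⊤-y , x , x∈p∧x≢y⇒x∈p-y (∈⊤ {x = x}) x≢y , x∉p)) ⟩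
  suc ∣ ⊤ {n} - y ∣ ≤⟨ x∈p⇒∣p-x∣<∣p∣ (∈⊤ {x = y}) ⟩
  ∣ ⊤ {n} ∣       ≡⟨ ∣⊤∣≡n n ⟩
  n               ∎
  where
  open ≤-Reasoning
  p⊆⊤-y : p ⊆ ⊤ - y
  p⊆⊤-y z∈p = x∈p∧x≢y⇒x∈p-y ∈⊤ (λ { refl → y∉p z∈p })

transpose-matchˡ : (i j : Fin n) → PC.transpose i j i ≡ j
transpose-matchˡ i j with i ≟ i
... | yes _   = refl
... | no  i≢i = contradiction refl i≢i

transpose-matchʳ : (i j : Fin n) → PC.transpose i j j ≡ i
transpose-matchʳ i j with j ≟ i
... | yes j≡i = j≡i
... | no  _   with j ≟ j
...   | yes _   = refl
...   | no  j≢j = contradiction refl j≢j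

transpose-fix : {i j k : Fin n} → k ≢ i → k ≢ j → PC.transpose i j k ≡ k
transpose-fix {i = i} {j} {k} k≢i k≢j with k ≟ i
... | yes k≡i = contradiction k≡i k≢i
... | no  _   with k ≟ j
...   | yes k≡j = contradiction k≡j k≢j
...   | no  _   = refl

_ᵀ : Bigraph n → Bigraph n
H ᵀ = record { adj = flip (adj H) }

Hits : Bigraph n → Permutation′ n → Subset n
Hits H σ = tabulate (λ a → adj H a (σ ⟨$⟩ʳ a))

Improvement : Bigraph n → (Permutation′ n → Set) → Permutation′ n → Set
Improvement H Inv σ = ∃ λ σ′ → Inv σ′ × Hits H σ ⊂ Hits H σ′

one-factor-or-stuck : (H : Bigraph n) (Inv : Permutation′ n → Set) {Stuck : Set} →
  (∀ σ → Inv σ → ∀ a → ¬ Edge H a (σ ⟨$⟩ʳ a) → Stuck ⊎ Improvement H Inv σ) →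
  ∀ σ → Inv σ → Stuck ⊎ Σ (OneFactor H) (Inv ∘ proj₁)
one-factor-or-stuck H Inv {Stuck} improve σ₀ = descend σ₀ (On.wellFounded (Hits H) ⊃-wellFounded σ₀)
  where
  descend : ∀ σ → Acc (_⊃_ on Hits H) σ → Inv σ → Stuck ⊎ Σ (OneFactor H) (Inv ∘ proj₁)
  descend σ (acc later) inv with any? (λ a → ¬? (adj H a (σ ⟨$⟩ʳ a) ≟ᵇ true))
  ... | no  noMiss     = inj₂ ((σ , λ a → decidable-stable (_ ≟ᵇ true) (noMiss ∘ (a ,_))) , inv)
  ... | yes (a , miss) with improve σ inv a miss
  ...   | inj₁ stuck             = inj₁ stuck
  ...   | inj₂ (σ′ , inv′ , ⊂σ′) = descend σ′ (later ⊂σ′) inv′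

Hits-⊂ : (H : Bigraph n) {σ σ′ : Permutation′ n} (a : Fin n) →
  (∀ x → Edge H x (σ ⟨$⟩ʳ x) → Edge H x (σ′ ⟨$⟩ʳ x)) →
  ¬ Edge H a (σ ⟨$⟩ʳ a) → Edge H a (σ′ ⟨$⟩ʳ a) → Hits H σ ⊂ Hits H σ′
Hits-⊂ H a keep miss hit =
  (λ {x} x∈ → ∈-tabulate⁺ _ (keep x (∈-tabulate⁻ _ x∈))) , a , ∈-tabulate⁺ _ hit , miss ∘ ∈-tabulate⁻ _

swap-improves : (H : Bigraph n) (σ : Permutation′ n) {a x : Fin n} → ¬ Edge H a (σ ⟨$⟩ʳ a) →
  Edge H a (σ ⟨$⟩ʳ x) → Edge H x (σ ⟨$⟩ʳ a) → Hits H σ ⊂ Hits H (transpose a x ∘ₚ σ)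
swap-improves H σ {a} {x} miss a~σx x~σa = Hits-⊂ H {σ} {transpose a x ∘ₚ σ} a keep miss hit
  where
  hit : Edge H a (σ ⟨$⟩ʳ PC.transpose a x a)
  hit rewrite transpose-matchˡ a x = a~σx
  keep : ∀ y → Edge H y (σ ⟨$⟩ʳ y) → Edge H y (σ ⟨$⟩ʳ PC.transpose a x y)
  keep y y~σy with toSum (y ≟ a) | toSum (y ≟ x)
  ... | inj₁ refl | _         = hit
  ... | inj₂ _    | inj₁ refl rewrite transpose-matchʳ a y = x~σa
  ... | inj₂ y≢a  | inj₂ y≢x  rewrite transpose-fix y≢a y≢x = y~σy

rotation-improves : (H : Bigraph n) (σ : Permutation′ n) {a x z : Fin n} → ¬ Edge H a (σ ⟨$⟩ʳ a) →
  Edge H a (σ ⟨$⟩ʳ x) → Edge H x (σ ⟨$⟩ʳ z) → Edge H z (σ ⟨$⟩ʳ a) → x ≢ z →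
  Hits H σ ⊂ Hits H (transpose x z ∘ₚ (transpose a x ∘ₚ σ))
rotation-improves H σ {a} {x} {z} miss a~σx x~σz z~σa x≢z =
  Hits-⊂ H {σ} {transpose x z ∘ₚ (transpose a x ∘ₚ σ)} a keep miss hit
  where
  a≢x : a ≢ x
  a≢x refl = miss a~σx
  a≢z : a ≢ z
  a≢z refl = miss z~σa
  hit : Edge H a (σ ⟨$⟩ʳ PC.transpose a x (PC.transpose x z a))
  hit rewrite transpose-fix a≢x a≢z | transpose-matchˡ a x = a~σx
  keep : ∀ y → Edge H y (σ ⟨$⟩ʳ y) → Edge H y (σ ⟨$⟩ʳ PC.transpose a x (PC.transpose x z y))
  keep y y~σy with toSum (y ≟ a) | toSum (y ≟ x) | toSum (y ≟ z)
  ... | inj₁ refl | _         | _         = hit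
  ... | inj₂ _    | inj₁ refl | _
    rewrite transpose-matchˡ y z | transpose-fix (a≢z ∘ sym) (x≢z ∘ sym) = x~σz
  ... | inj₂ _    | inj₂ _    | inj₁ refl
    rewrite transpose-matchʳ x y | transpose-matchʳ a x = z~σa
  ... | inj₂ y≢a  | inj₂ y≢x  | inj₂ y≢z
    rewrite transpose-fix y≢x y≢z | transpose-fix y≢a y≢x = y~σy

preimageNA : Bigraph n → Permutation′ n → Fin n → Subset n
preimageNA H σ a = tabulate (λ x → adj H a (σ ⟨$⟩ʳ x))

∣preimageNA∣≡degA : (H : Bigraph n) (σ : Permutation′ n) (a : Fin n) → ∣ preimageNA H σ a ∣ ≡ degA H a
∣preimageNA∣≡degA H σ a = ∣tabulate∘permute∣ (adj H a) σ

swapPartners : Bigraph n → Permutation′ n → Fin n → Subset n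
swapPartners H σ a = preimageNA H σ a ∩ NB H (σ ⟨$⟩ʳ a)

∈swapPartners⁻ : (H : Bigraph n) (σ : Permutation′ n) {a x : Fin n} → x ∈ swapPartners H σ a →
  Edge H a (σ ⟨$⟩ʳ x) × Edge H x (σ ⟨$⟩ʳ a)
∈swapPartners⁻ H σ {a} x∈ =
  let (x∈P , x∈Q) = x∈p∩q⁻ _ _ x∈ in
  ∈-tabulate⁻ (λ x → adj H a (σ ⟨$⟩ʳ x)) x∈P , ∈-tabulate⁻ (λ x → adj H x (σ ⟨$⟩ʳ a)) x∈Q

miss⇒∉preimageNA∪NB : (H : Bigraph n) (σ : Permutation′ n) {a : Fin n} → ¬ Edge H a (σ ⟨$⟩ʳ a) →
  a ∉ preimageNA H σ a ∪ NB H (σ ⟨$⟩ʳ a)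
miss⇒∉preimageNA∪NB H σ miss a∈ = [ miss ∘ ∈-tabulate⁻ _ , miss ∘ ∈-tabulate⁻ _ ]′ (x∈p∪q⁻ _ _ a∈)

miss⇒∣preimageNA∪NB∣<n : (H : Bigraph n) (σ : Permutation′ n) {a : Fin n} → ¬ Edge H a (σ ⟨$⟩ʳ a) →
  ∣ preimageNA H σ a ∪ NB H (σ ⟨$⟩ʳ a) ∣ < n
miss⇒∣preimageNA∪NB∣<n H σ miss = x∉p⇒∣p∣<n (miss⇒∉preimageNA∪NB H σ miss)

2≤∣swapPartners∣ : (H : Bigraph n) {t : ℕ} → MinDeg≥ H t → n < t + t →
  (σ : Permutation′ n) {a : Fin n} → ¬ Edge H a (σ ⟨$⟩ʳ a) → 2 ≤ ∣ swapPartners H σ a ∣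
2≤∣swapPartners∣ {n} H {t} (degA≥ , degB≥) n<2t σ {a} miss = ∣p∪q∣+m≤∣p∣+∣q∣⇒m≤∣p∩q∣ P Q (begin
  ∣ P ∪ Q ∣ + 2   ≡⟨ +-comm _ 2 ⟩
  2 + ∣ P ∪ Q ∣   ≤⟨ s≤s (miss⇒∣preimageNA∪NB∣<n H σ miss) ⟩
  suc n           ≤⟨ n<2t ⟩
  t + t           ≤⟨ +-mono-≤ (subst (t ≤_) (sym (∣preimageNA∣≡degA H σ a)) (degA≥ a)) (degB≥ _) ⟩
  ∣ P ∣ + ∣ Q ∣   ∎)
  where
  open ≤-Reasoning
  P = preimageNA H σ a
  Q = NB H (σ ⟨$⟩ʳ a)

edge-preserving-improvement : (H : Bigraph n) {t : ℕ} → MinDeg≥ H t → n < t + t →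
  ∀ {a b} → Edge H a b → ∀ σ → σ ⟨$⟩ʳ a ≡ b → ∀ a₁ → ¬ Edge H a₁ (σ ⟨$⟩ʳ a₁) →
  Improvement H (λ σ′ → σ′ ⟨$⟩ʳ a ≡ b) σ
edge-preserving-improvement H minDeg n<2t {a} {b} ab σ σa≡b a₁ miss =
  let (x , x∈swapPartners , x∉⁅a⁆) = ∣q∣<∣p∣⇒∃∈p∖q {q = ⁅ a ⁆} {p = swapPartners H σ a₁}
        (subst (_< ∣ swapPartners H σ a₁ ∣) (sym (∣⁅x⁆∣≡1 a)) (2≤∣swapPartners∣ H minDeg n<2t σ miss))
      (a₁~σx , x~σa₁) = ∈swapPartners⁻ H σ x∈swapPartners
  in transpose a₁ x ∘ₚ σ ,
     trans (cong (σ ⟨$⟩ʳ_) (transpose-fix a≢a₁ (x∉⁅y⁆⇒x≢y x∉⁅a⁆ ∘ sym))) σa≡b ,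
     swap-improves H σ miss a₁~σx x~σa₁
  where
  a≢a₁ : a ≢ a₁
  a≢a₁ refl = miss (subst (Edge H a) (sym σa≡b) ab)

one-factor-through-edge : (H : Bigraph n) {t : ℕ} → MinDeg≥ H t → n < t + t →
  ∀ {a b} → Edge H a b → Σ (OneFactor H) (λ F → Contains {H = H} F a b)
one-factor-through-edge H minDeg n<2t {a} {b} ab =
  [ (λ ()) , (λ F → F) ]′ (one-factor-or-stuck H (λ σ → σ ⟨$⟩ʳ a ≡ b) {Stuck = ⊥}
    (λ σ σa≡b a₁ miss → inj₂ (edge-preserving-improvement H minDeg n<2t ab σ σa≡b a₁ miss))
    (transpose a b) (transpose-matchˡ a b))

record Stuck (H : Bigraph n) : Set where
  field
    σ          : Permutation′ n
    a          : Fin n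
    miss       : ¬ Edge H a (σ ⟨$⟩ʳ a)
    noSwap     : Empty (swapPartners H σ a)
    noRotation : ∀ x z → Edge H a (σ ⟨$⟩ʳ x) → Edge H z (σ ⟨$⟩ʳ a) → ¬ Edge H x (σ ⟨$⟩ʳ z)

improvement-or-stuck : (H : Bigraph n) (σ : Permutation′ n) (a : Fin n) → ¬ Edge H a (σ ⟨$⟩ʳ a) →
  Stuck H ⊎ Improvement H (λ _ → Unit) σ
improvement-or-stuck H σ a miss with nonempty? (swapPartners H σ a)
... | yes (x , x∈swapPartners) =
  let (a~σx , x~σa) = ∈swapPartners⁻ H σ x∈swapPartners in
  inj₂ (transpose a x ∘ₚ σ , tt , swap-improves H σ miss a~σx x~σa)
... | no noSwap with any? (λ x → any? (λ z →
      adj H a (σ ⟨$⟩ʳ x) ≟ᵇ true ×-dec adj H z (σ ⟨$⟩ʳ a) ≟ᵇ true ×-dec adj H x (σ ⟨$⟩ʳ z) ≟ᵇ true))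
...   | yes (x , z , a~σx , z~σa , x~σz) =
  inj₂ (transpose x z ∘ₚ (transpose a x ∘ₚ σ) , tt , rotation-improves H σ miss a~σx x~σz z~σa x≢z)
  where
  x≢z : x ≢ z
  x≢z refl = noSwap (x , x∈p∩q⁺ (∈-tabulate⁺ _ a~σx , ∈-tabulate⁺ _ z~σa))
...   | no noRotation = inj₁ (record
  { σ = σ ; a = a ; miss = miss ; noSwap = noSwap
  ; noRotation = λ x z a~σx z~σa x~σz → noRotation (x , z , a~σx , z~σa , x~σz) })

squeeze : ∀ {k p q} → k ≤ p → k ≤ q → p + q ≤ k + k → p ≡ k × q ≡ k
squeeze {k} {p} {q} k≤p k≤q p+q≤k+k =
  ≤-antisym (+-cancelʳ-≤ q p k (≤-trans p+q≤k+k (+-monoʳ-≤ k k≤q))) k≤p ,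
  ≤-antisym (+-cancelˡ-≤ p q k (≤-trans p+q≤k+k (+-monoˡ-≤ k k≤p))) k≤q

2k+1≡k+[k+1] : ∀ k → suc (2 * k) ≡ k + (k + 1)
2k+1≡k+[k+1] = solve-∀

2k+1∸k≡k+1 : ∀ k → suc (2 * k) ∸ k ≡ k + 1
2k+1∸k≡k+1 k = trans (cong (_∸ k) (2k+1≡k+[k+1] k)) (m+n∸m≡n k (k + 1))

2k+1∸[k+1]≡k : ∀ k → suc (2 * k) ∸ (k + 1) ≡ k
2k+1∸[k+1]≡k k =
  trans (cong (_∸ (k + 1)) (trans (2k+1≡k+[k+1] k) (+-comm k (k + 1)))) (m+n∸m≡n (k + 1) k)

2k+1<[k+1]+[k+1] : ∀ k → suc (2 * k) < (k + 1) + (k + 1)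
2k+1<[k+1]+[k+1] k = ≤-reflexive (2+2k≡[k+1]+[k+1] k)
  where
  2+2k≡[k+1]+[k+1] : ∀ k → 2 + 2 * k ≡ (k + 1) + (k + 1)
  2+2k≡[k+1]+[k+1] = solve-∀

module StuckAnalysis {k : ℕ} (H : Bigraph (suc (2 * k))) (minDeg : MinDeg≥ H k) (stuck : Stuck H) where
  open Stuck stuck

  P Q : Subset (suc (2 * k))
  P = preimageNA H σ a
  Q = NB H (σ ⟨$⟩ʳ a)

  ∈P⁻ : ∀ {x} → x ∈ P → Edge H a (σ ⟨$⟩ʳ x)
  ∈P⁻ = ∈-tabulate⁻ (λ x → adj H a (σ ⟨$⟩ʳ x))

  ∈Q⁻ : ∀ {x} → x ∈ Q → Edge H x (σ ⟨$⟩ʳ a)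
  ∈Q⁻ = ∈-tabulate⁻ (λ x → adj H x (σ ⟨$⟩ʳ a))

  ∣P∪Q∣≡∣P∣+∣Q∣ : ∣ P ∪ Q ∣ ≡ ∣ P ∣ + ∣ Q ∣
  ∣P∪Q∣≡∣P∣+∣Q∣ = Empty[p∩q]⇒∣p∪q∣≡∣p∣+∣q∣ P Q noSwap

  ∣P∣≡k×∣Q∣≡k : ∣ P ∣ ≡ k × ∣ Q ∣ ≡ k
  ∣P∣≡k×∣Q∣≡k = squeeze
    (subst (k ≤_) (sym (∣preimageNA∣≡degA H σ a)) (proj₁ minDeg a))
    (proj₂ minDeg (σ ⟨$⟩ʳ a))
    (begin
      ∣ P ∣ + ∣ Q ∣  ≡⟨ ∣P∪Q∣≡∣P∣+∣Q∣ ⟨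
      ∣ P ∪ Q ∣      ≤⟨ ≤-pred (miss⇒∣preimageNA∪NB∣<n H σ miss) ⟩
      2 * k          ≡⟨ cong (k +_) (+-identityʳ k) ⟩
      k + k          ∎)
    where open ≤-Reasoning

  covered : ∀ y → y ≢ a → y ∈ P ⊎ y ∈ Q
  covered y y≢a with y ∈? (P ∪ Q)
  ... | yes y∈P∪Q = x∈p∪q⁻ P Q y∈P∪Q
  ... | no  y∉P∪Q = contradiction (x≢y∉p⇒2+∣p∣≤n y≢a y∉P∪Q (miss⇒∉preimageNA∪NB H σ miss)) 2+∣P∪Q∣≰n
    where
    2+∣P∪Q∣≰n : ¬ 2 + ∣ P ∪ Q ∣ ≤ suc (2 * k)
    2+∣P∪Q∣≰n rewrite ∣P∪Q∣≡∣P∣+∣Q∣ | proj₁ ∣P∣≡k×∣Q∣≡k | proj₂ ∣P∣≡k×∣Q∣≡k | +-identityʳ k =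
      1+n≰n ∘ ≤-pred

  X Y : Subset (suc (2 * k))
  X = ∁ Q
  Y = ∁ (NA H a)

  ∣X∣≡k+1 : ∣ X ∣ ≡ k + 1
  ∣X∣≡k+1 = trans (∣p∣≡m⇒∣∁p∣≡n∸m {p = Q} (proj₂ ∣P∣≡k×∣Q∣≡k)) (2k+1∸k≡k+1 k)

  ∣Y∣≡k+1 : ∣ Y ∣ ≡ k + 1
  ∣Y∣≡k+1 = trans (∣p∣≡m⇒∣∁p∣≡n∸m {p = NA H a} ∣NA∣≡k) (2k+1∸k≡k+1 k)
    where
    ∣NA∣≡k : ∣ NA H a ∣ ≡ k
    ∣NA∣≡k = trans (sym (∣preimageNA∣≡degA H σ a)) (proj₁ ∣P∣≡k×∣Q∣≡k)

  noEdges : NoEdges H X Y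
  noEdges u v u∈X v∈Y = ¬-not u≁v
    where
    u≁σa : ¬ Edge H u (σ ⟨$⟩ʳ a)
    u≁σa = x∈∁p⇒x∉p u∈X ∘ ∈-tabulate⁺ (λ x → adj H x (σ ⟨$⟩ʳ a))
    a≁v : ¬ Edge H a v
    a≁v = x∈∁p⇒x∉p v∈Y ∘ ∈-tabulate⁺ (adj H a)
    z = σ ⟨$⟩ˡ v
    σz≡v : σ ⟨$⟩ʳ z ≡ v
    σz≡v = inverseʳ σ
    u≁v : ¬ Edge H u v
    u≁v with toSum (u ≟ a) | toSum (z ≟ a)
    ... | inj₁ refl | _        = a≁v
    ... | inj₂ _    | inj₁ z≡a = subst (¬_ ∘ Edge H u) (trans (cong (σ ⟨$⟩ʳ_) (sym z≡a)) σz≡v) u≁σa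
    ... | inj₂ u≢a  | inj₂ z≢a = noRotation u z a~σu z~σa ∘ subst (Edge H u) (sym σz≡v)
      where
      a~σu : Edge H a (σ ⟨$⟩ʳ u)
      a~σu = [ ∈P⁻ , (λ u∈Q → contradiction (∈Q⁻ u∈Q) u≁σa) ]′ (covered u u≢a)
      z~σa : Edge H z (σ ⟨$⟩ʳ a)
      z~σa = [ (λ z∈P → contradiction (subst (Edge H a) σz≡v (∈P⁻ z∈P)) a≁v) , ∈Q⁻ ]′ (covered z z≢a)

  deficient-pair : ∃₂ λ X Y → ∣ X ∣ ≡ k + 1 × ∣ Y ∣ ≡ k + 1 × NoEdges H X Y
  deficient-pair = X , Y , ∣X∣≡k+1 , ∣Y∣≡k+1 , noEdges

NoEdges⇒NB⊆∁ : (H : Bigraph n) {X Y : Subset n} → NoEdges H X Y → ∀ {b} → b ∈ Y → NB H b ⊆ ∁ X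
NoEdges⇒NB⊆∁ H noEdges {b} b∈Y a∈NB =
  x∉p⇒x∈∁p (λ a∈X → not-¬ (∈-tabulate⁻ (λ a → adj H a b) a∈NB) (noEdges _ b a∈X b∈Y))

NoEdges⇒NB≡∁ : (H : Bigraph n) {X Y : Subset n} → NoEdges H X Y →
  ∀ {b} → b ∈ Y → ∣ ∁ X ∣ ≤ degB H b → NB H b ≡ ∁ X
NoEdges⇒NB≡∁ H noEdges b∈Y ∣∁X∣≤deg = p⊆q⇒∣q∣≤∣p∣⇒p≡q (NoEdges⇒NB⊆∁ H noEdges b∈Y) ∣∁X∣≤deg

NoEdges⇒CompleteTo : (H : Bigraph n) {X Y : Subset n} → NoEdges H X Y →
  (∀ b → ∣ ∁ X ∣ ≤ degB H b) → CompleteTo H (∁ X) Y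
NoEdges⇒CompleteTo H noEdges ∣∁X∣≤deg a b a∈∁X b∈Y =
  ∈-tabulate⁻ (λ a → adj H a b) (subst (a ∈_) (sym (NoEdges⇒NB≡∁ H noEdges b∈Y (∣∁X∣≤deg b))) a∈∁X)

NoEdges-unique : (H : Bigraph n) {X Y X′ Y′ : Subset n} → NoEdges H X Y → NoEdges H X′ Y′ →
  n < ∣ Y ∣ + ∣ Y′ ∣ → (∀ b → ∣ ∁ X ∣ ≤ degB H b) → (∀ b → ∣ ∁ X′ ∣ ≤ degB H b) → X ≡ X′
NoEdges-unique H {Y = Y} {Y′ = Y′} noEdges noEdges′ n<∣Y∣+∣Y′∣ ∣∁X∣≤deg ∣∁X′∣≤deg =
  let (y , y∈Y∩Y′) = n<∣p∣+∣q∣⇒Nonempty[p∩q] Y Y′ n<∣Y∣+∣Y′∣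
      (y∈Y , y∈Y′) = x∈p∩q⁻ Y Y′ y∈Y∩Y′
  in ∁-injective (trans (sym (NoEdges⇒NB≡∁ H noEdges y∈Y (∣∁X∣≤deg y)))
                        (NoEdges⇒NB≡∁ H noEdges′ y∈Y′ (∣∁X′∣≤deg y)))

NoEdges-ᵀ : (H : Bigraph n) {X Y : Subset n} → NoEdges H X Y → NoEdges (H ᵀ) Y X
NoEdges-ᵀ H noEdges b a b∈Y a∈X = noEdges a b a∈X b∈Y

deficient-pair-structure : ∀ {k} (H : Bigraph (suc (2 * k))) → MinDeg≥ H k →
  ∀ {X Y} → ∣ X ∣ ≡ k + 1 → ∣ Y ∣ ≡ k + 1 → NoEdges H X Y →
  ((X′ Y′ : Subset (suc (2 * k))) → ∣ X′ ∣ ≡ k + 1 → ∣ Y′ ∣ ≡ k + 1 →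
     NoEdges H X′ Y′ → (X′ ≡ X) × (Y′ ≡ Y))
  × CompleteTo H X (∁ Y)
  × CompleteTo H (∁ X) Y
deficient-pair-structure {k} H (degA≥ , degB≥) {X} {Y} ∣X∣ ∣Y∣ noEdges =
  (λ X′ Y′ ∣X′∣ ∣Y′∣ noEdges′ →
    NoEdges-unique H noEdges′ noEdges (n<∣Z∣+∣Z′∣ Y′ Y ∣Y′∣ ∣Y∣)
      (∣∁Z∣≤ degB≥ X′ ∣X′∣) (∣∁Z∣≤ degB≥ X ∣X∣) ,
    NoEdges-unique (H ᵀ) (NoEdges-ᵀ H noEdges′) (NoEdges-ᵀ H noEdges) (n<∣Z∣+∣Z′∣ X′ X ∣X′∣ ∣X∣)
      (∣∁Z∣≤ degA≥ Y′ ∣Y′∣) (∣∁Z∣≤ degA≥ Y ∣Y∣)) ,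
  (λ a b a∈X b∈∁Y → NoEdges⇒CompleteTo (H ᵀ) (NoEdges-ᵀ H noEdges) (∣∁Z∣≤ degA≥ Y ∣Y∣) b a b∈∁Y a∈X) ,
  NoEdges⇒CompleteTo H noEdges (∣∁Z∣≤ degB≥ X ∣X∣)
  where
  ∣∁Z∣≤ : {deg : Fin (suc (2 * k)) → ℕ} → (∀ b → k ≤ deg b) →
          ∀ Z → ∣ Z ∣ ≡ k + 1 → ∀ b → ∣ ∁ Z ∣ ≤ deg b
  ∣∁Z∣≤ k≤deg Z ∣Z∣ b =
    subst (_≤ _) (sym (trans (∣p∣≡m⇒∣∁p∣≡n∸m {p = Z} ∣Z∣) (2k+1∸[k+1]≡k k))) (k≤deg b)
  n<∣Z∣+∣Z′∣ : ∀ Z Z′ → ∣ Z ∣ ≡ k + 1 → ∣ Z′ ∣ ≡ k + 1 → suc (2 * k) < ∣ Z ∣ + ∣ Z′ ∣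
  n<∣Z∣+∣Z′∣ Z Z′ ∣Z∣ ∣Z′∣ = subst (suc (2 * k) <_) (sym (cong₂ _+_ ∣Z∣ ∣Z′∣)) (2k+1<[k+1]+[k+1] k)

deficient-pair : ∀ {k} (H : Bigraph (suc (2 * k))) → MinDeg≥ H k → ¬ OneFactor H →
  ∃₂ λ X Y → ∣ X ∣ ≡ k + 1 × ∣ Y ∣ ≡ k + 1 × NoEdges H X Y
deficient-pair H minDeg noOneFactor =
  [ StuckAnalysis.deficient-pair H minDeg , (λ (F , _) → contradiction F noOneFactor) ]′
    (one-factor-or-stuck H (λ _ → Unit) (λ σ _ → improvement-or-stuck H σ) id tt)

lemma9 : (k : ℕ) → 1 ≤ k →
    ((H : Bigraph (suc (2 * k))) → MinDeg≥ H (k + 1) →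
      (a b : Fin (suc (2 * k))) → Edge H a b →
      Σ (OneFactor H) (λ F → Contains {H = H} F a b))
    ×
    ((H : Bigraph (suc (2 * k))) → MinDeg≥ H k → ¬ OneFactor H →
      Σ (Subset (suc (2 * k))) (λ X → Σ (Subset (suc (2 * k))) (λ Y →
        ((∣ X ∣ ≡ k + 1) × (∣ Y ∣ ≡ k + 1) × NoEdges H X Y)
        ×
        (((X′ Y′ : Subset (suc (2 * k))) → ∣ X′ ∣ ≡ k + 1 → ∣ Y′ ∣ ≡ k + 1 →
            NoEdges H X′ Y′ → (X′ ≡ X) × (Y′ ≡ Y))
         × CompleteTo H X (∁ Y)
         × CompleteTo H (∁ X) Y))))
lemma9 k _ =
  (λ H minDeg a b → one-factor-through-edge H minDeg (2k+1<[k+1]+[k+1] k)) ,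
  (λ H minDeg noOneFactor →
    let (X , Y , ∣X∣ , ∣Y∣ , noEdges) = deficient-pair H minDeg noOneFactor
    in X , Y , (∣X∣ , ∣Y∣ , noEdges) , deficient-pair-structure H minDeg ∣X∣ ∣Y∣ noEdges)
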